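{- Let $X$ be a finite set and $\mathcal{A}$ a collection of distinct subsets of $X$ with $|\mathcal{A}|=|X|$. Then $(\mathcal{A},X)$ is extremal if and only if there exist a digraph $D\in(K_1,\oplus,\overrightarrow{\triangleleft})$ and a graph isomorphism from $B(\mathcal{A},X)$ to $B(D)$ mapping $X$ onto the part $\{x_1,\dots,x_n\}$ and $\mathcal{A}$ onto the part $\{x'_1,\dots,x'_n\}$ (equivalently: a bijection $f:X\to V(D)$ with $\mathcal{A}=\{f^{ -1}(B_1^+(v)) : v\in V(D)\}$).
   Context: A set system $(\mathcal{A},X)$ is extremal if the members of $\mathcal{A}$ are distinct and nonempty, and for every $x\in X$ either there is $A\in\mathcal{A}$ with $A-\{x\}=\emptyset$ or there are distinct $A,A'\in\mathcal{A}$ with $A-\{x\}=A'-\{x\}$. The incidence bipartite graph $B(\mathcal{A},X)$ has parts $\mathcal{A}$ and $X$, with $A\in\mathcal{A}$ adjacent to $x\in X$ iff $x\in A$. Digraphs have no loops or multiple arcs; for a vertex $u$, $B_1^+(u)$ is $u$ together with all $w$ having an arc $\overrightarrow{wu}$. For a digraph $D$ on $\{x_1,\dots,x_n\}$, $B(D)$ is the bipartite graph with parts $\{x_1,\dots,x_n\}$ and $\{x'_1,\dots,x'_n\}$ in which $x_i\sim x'_j$ iff $\overrightarrow{x_ix_j}$ is an arc or $i=j$. For digraphs $D_1,D_2$ on disjoint vertex sets, $D_1\oplus D_2$ is their disjoint union; for a digraph $D$ and a new vertex $x$, $x\overrightarrow{\triangleleft}(D)$ is obtained by adding $x$ and all arcs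 $\overrightarrow{xv}$, $v\in V(D)$. $(K_1,\oplus,\overrightarrow{\triangleleft})$ is the class of digraphs built from the one-vertex digraph $K_1$ by repeated applications of $\oplus$ and $\overrightarrow{\triangleleft}$. -}

module Defs where

open import Data.Nat using (ℕ; suc; _+_)
open import Data.Fin using (Fin; zero; suc; splitAt)
open import Data.Fin.Subset using (Subset; _∈_; _-_; Nonempty; Empty)
open import Data.Sum using (_⊎_; inj₁; inj₂)
open import Data.Product using (_×_; ∃; ∃-syntax)
open import Data.Empty using (⊥)
open import Data.Unit using (⊤)
open import Relation.Binary.PropositionalEquality using (_≡_; _≢_)
open import Function.Definitions using (Injective)

-- A set system (𝒜, X) with X = Fin n and |𝒜| = |X| = n, given as an
-- injective family 𝒜 : Fin n → Subset n (injective = members distinct).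

Extremal : ∀ {n} → (Fin n → Subset n) → Set
Extremal {n} 𝒜 =
  Injective _≡_ _≡_ 𝒜
  × (∀ i → Nonempty (𝒜 i))
  × (∀ (x : Fin n) →
       (∃[ i ] Empty (𝒜 i - x))
       ⊎ (∃[ i ] ∃[ j ] (i ≢ j × 𝒜 i - x ≡ 𝒜 j - x)))

-- Digraphs of the class (K₁, ⊕, →◁), as construction terms; a term of
-- type DTerm n describes a digraph on vertex set Fin n.
data DTerm : ℕ → Set where
  K₁   : DTerm 1
  _⊕_  : ∀ {m k} → DTerm m → DTerm k → DTerm (m + k)
  cone : ∀ {m} → DTerm m → DTerm (suc m)   -- x →◁ (D): new vertex is zero

ArcSum : ∀ {m k} → DTerm m → DTerm k → Fin m ⊎ Fin k → Fin m ⊎ Fin k → Set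
Arc : ∀ {n} → DTerm n → Fin n → Fin n → Set

ArcSum D E (inj₁ u) (inj₁ v) = Arc D u v
ArcSum D E (inj₁ u) (inj₂ v) = ⊥
ArcSum D E (inj₂ u) (inj₁ v) = ⊥
ArcSum D E (inj₂ u) (inj₂ v) = Arc E u v

Arc K₁ u v = ⊥
Arc (_⊕_ {m} {k} D E) u v = ArcSum D E (splitAt m u) (splitAt m v)
Arc (cone D) zero zero = ⊥
Arc (cone D) zero (suc v) = ⊤
Arc (cone D) (suc u) zero = ⊥
Arc (cone D) (suc u) (suc v) = Arc D u v

-- Adjacency in B(D): x_u ~ x'_v iff u → v is an arc or u = v.
BAdj : ∀ {n} → DTerm n → Fin n → Fin n → Set
BAdj D u v = Arc D u v ⊎ u ≡ v

-- For a digraph D built from K₁ by ⊕ and x →◁ (−), every vertex v has B₁⁺(v) = {v} or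
-- B₁⁺(v) = B₁⁺(p) ∪ {v} for some p ≠ v (induction on D: the old sources become children of
-- a new cone vertex).  Read through the isomorphism, this is extremality at the point of X
-- matched with v.
--
-- Conversely, extremality at x gives a flip P ⊂ C = P ∪ {x} with C ∈ 𝒜 and P ∈ 𝒜 ∪ {∅}.
-- Flips in pairwise distinct directions between members of a family form a forest on it,
-- so they are fewer than its members, and fewer by c if they cross none of c nonempty
-- classes.  If C(x) = C(y) with x ≠ y, the other |X| − 1 flips cross none of three such
-- classes of the |X| + 1 sets 𝒜 ∪ {∅}, which is impossible; so x ↦ C is a bijection X → 𝒜.
-- Then x ≼ y ⇔ x ∈ C(y) is a forest order (C(y) − y is ∅ or the set C of a parent of y),
-- and every forest order on a nonempty finite set is the closed in-adjacency of a digraph in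
-- (K₁, ⊕, →◁): a minimal element r is either below everything, and the order is a cone over
-- the rest, or the up-set of r and its complement are incomparable, and the order is a
-- disjoint union.

module Submission where

open import Defs
open import Data.Empty using (⊥; ⊥-elim)
open import Data.Fin using (Fin; zero; suc; splitAt; join; punchIn; punchOut)
open import Data.Fin.Permutation using (lift₀; transpose; ↔⇒≡)
open import Data.Fin.Properties
  using (_≟_; suc-injective; +↔⊎; splitAt-join; join-splitAt; all?; any?; ¬∀⟶∃¬; pigeonhole;
         punchOut-injective; punchIn-injective; punchInᵢ≢i; <-irrefl)
open import Data.Fin.Subset
  using (Subset; _∈_; _∉_; _⊆_; _⊂_; _─_; _-_; ⁅_⁆; ∣_∣; Nonempty; Empty; inside; outside)
  renaming (⊥ to ∅)
open import Data.Fin.Subset.Properties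
  using (_∈?_; ∉⊥; ⊆-antisym; p─q⊆p; x∉⁅y⁆⇒x≢y; x∈p∧x≢y⇒x∈p-y; p⊂q⇒∣p∣<∣q∣)
open import Data.List using (List; []; _∷_; allFin; filter; length; map)
open import Data.List.Membership.Propositional using () renaming (_∈_ to _∈ₗ_)
open import Data.List.Membership.Propositional.Properties
  using (∈-allFin; ∈-filter⁺; ∈-filter⁻; ∈-map⁺; ∈-map⁻)
open import Data.List.Properties using (length-filter; length-map; length-tabulate)
open import Data.List.Relation.Unary.All using (All; lookup)
import Data.List.Relation.Unary.All as All
open import Data.List.Relation.Unary.AllPairs using (_∷_)
open import Data.List.Relation.Unary.Any using (here; there)
open import Data.List.Relation.Unary.Unique.Propositional using (Unique)
open import Data.List.Relation.Unary.Unique.Propositional.Properties using (filter⁺; map⁺; allFin⁺)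
open import Data.Nat using (ℕ; zero; suc; _+_; _≤_; _<_; z≤n; s≤s)
open import Data.Nat.Induction using (<-rec; <-wellFounded)
open import Data.Nat.Properties
  using (n<1+n; m<m+n; m<n+m; +-suc; +-mono-≤; +-commutativeSemigroup; module ≤-Reasoning)
import Data.Nat.Properties as ℕ
open import Algebra.Properties.CommutativeSemigroup +-commutativeSemigroup using (interchange)
open import Data.Product using (Σ; ∃; ∃-syntax; _×_; _,_; proj₁; proj₂)
open import Data.Sum using (_⊎_; inj₁; inj₂; map₁; map₂)
open import Data.Sum.Algebra using (⊎-comm)
open import Data.Sum.Function.Propositional using (_⊎-⇔_; _⊎-↔_)
open import Data.Sum.Properties using (inj₁-injective; inj₂-injective)
open import Data.Sum.Relation.Binary.Pointwise using (Pointwise; inj₁; inj₂; drop-inj₁; drop-inj₂)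
open import Data.Unit using (⊤; tt)
open import Data.Vec using (_∷_; here; there)
open import Function using (_∘_; _on_; id)
open import Function.Bundles
  using (_⇔_; mk⇔; Equivalence; _↔_; Inverse; mk↔ₛ′; _⤖_; Bijection; Injection)
open import Function.Construct.Composition using (_⇔-∘_; _↔-∘_)
open import Function.Construct.Symmetry using (⇔-sym)
open import Function.Definitions using (Injective)
open import Function.Properties.Bijection using (⤖⇒↔)
open import Function.Properties.Equivalence using () renaming (refl to ⇔-refl)
open import Function.Properties.Inverse using (↔-refl; ↔-sym; ↔⇒↣; ↔⇒⤖)
open import Function.Related.Propositional using (module EquationalReasoning)
open import Induction.WellFounded using (WellFounded; Acc; acc; module Subrelation)
open import Relation.Binary.PropositionalEquality
  using (_≡_; _≢_; refl; sym; trans; cong; subst; subst₂; ≢-sym)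
import Relation.Binary.Construct.On as On
open import Relation.Nullary using (¬_; Dec; yes; no; ¬?)
open import Relation.Nullary.Decidable using (decidable-stable)

private
  variable
    m k n : ℕ
    A B : Set

x∈p─q⇒x∉q : (p q : Subset n) {x : Fin n} → x ∈ p ─ q → x ∉ q
x∈p─q⇒x∉q (inside ∷ p) (outside ∷ q) here = λ ()
x∈p─q⇒x∉q (_ ∷ p) (_ ∷ q) (there x∈p─q) (there x∈q) = x∈p─q⇒x∉q p q x∈p─q x∈q

x∈p-y⇔x∈p×x≢y : {p : Subset n} {x y : Fin n} → x ∈ p - y ⇔ (x ∈ p × x ≢ y)
x∈p-y⇔x∈p×x≢y {p = p} {x} {y} = mk⇔
  (λ x∈p-y → p─q⊆p p ⁅ y ⁆ x∈p-y , x∉⁅y⁆⇒x≢y (x∈p─q⇒x∉q p ⁅ y ⁆ x∈p-y))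
  (λ (x∈p , x≢y) → x∈p∧x≢y⇒x∈p-y x∈p x≢y)

p-x≡q-x⇔agree : {p q : Subset n} {x : Fin n} → p - x ≡ q - x ⇔ (∀ {y} → y ≢ x → y ∈ p ⇔ y ∈ q)
p-x≡q-x⇔agree {p = p} {q} {x} = mk⇔
  (λ p-x≡q-x {y} y≢x → mk⇔ (transfer p-x≡q-x y≢x) (transfer (sym p-x≡q-x) y≢x))
  (λ agree → ⊆-antisym (restrict (λ {y} y≢x → Equivalence.to (agree y≢x)))
                       (restrict (λ {y} y≢x → Equivalence.from (agree y≢x))))
  where
  transfer : ∀ {p q : Subset _} → p - x ≡ q - x → ∀ {y} → y ≢ x → y ∈ p → y ∈ q
  transfer p-x≡q-x {y} y≢x y∈p =
    proj₁ (Equivalence.to x∈p-y⇔x∈p×x≢y (subst (y ∈_) p-x≡q-x (x∈p∧x≢y⇒x∈p-y y∈p y≢x)))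
  restrict : ∀ {p q : Subset _} → (∀ {y} → y ≢ x → y ∈ p → y ∈ q) → p - x ⊆ q - x
  restrict p→q y∈p-x with Equivalence.to x∈p-y⇔x∈p×x≢y y∈p-x
  ... | y∈p , y≢x = x∈p∧x≢y⇒x∈p-y (p→q y≢x y∈p) y≢x

agree⇒≡ : {p q : Subset n} {x : Fin n} → (∀ {y} → y ≢ x → y ∈ p ⇔ y ∈ q) → (x ∈ p ⇔ x ∈ q) → p ≡ q
agree⇒≡ {p = p} {q} {x} agree at-x =
  ⊆-antisym (λ {y} → Equivalence.to (agree-everywhere y)) (λ {y} → Equivalence.from (agree-everywhere y))
  where
  agree-everywhere : ∀ y → y ∈ p ⇔ y ∈ q
  agree-everywhere y with y ≟ x
  ... | yes refl = at-x
  ... | no  y≢x  = agree y≢x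

record Flip (z : Fin n) (p q : Subset n) : Set where
  field
    z∉p   : z ∉ p
    z∈q   : z ∈ q
    agree : ∀ {w} → w ≢ z → w ∈ p ⇔ w ∈ q

  p⊆q : p ⊆ q
  p⊆q {w} w∈p = Equivalence.to (agree w≢z) w∈p
    where
    w≢z : w ≢ z
    w≢z refl = z∉p w∈p

  p⊂q : p ⊂ q
  p⊂q = p⊆q , z , z∈q , z∉p

flip-from-∅ : {p : Subset n} {x : Fin n} → Nonempty p → Empty (p - x) → Flip x ∅ p
flip-from-∅ {p = p} {x} (w , w∈p) p-x-empty = record
  { z∉p   = ∉⊥
  ; z∈q   = x∈p
  ; agree = λ y≢x → mk⇔ (⊥-elim ∘ ∉⊥) (⊥-elim ∘ only-x y≢x)
  }
  where
  only-x : ∀ {y} → y ≢ x → y ∉ p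
  only-x y≢x y∈p = p-x-empty (_ , x∈p∧x≢y⇒x∈p-y y∈p y≢x)
  x∈p : x ∈ p
  x∈p with w ≟ x
  ... | yes refl = w∈p
  ... | no  w≢x  = ⊥-elim (only-x w≢x w∈p)

flip-between : {p q : Subset n} {x : Fin n} → p ≢ q → (∀ {y} → y ≢ x → y ∈ p ⇔ y ∈ q) →
  Flip x p q ⊎ Flip x q p
flip-between {p = p} {q} {x} p≢q agree with x ∈? p | x ∈? q
... | no  x∉p | yes x∈q = inj₁ record { z∉p = x∉p ; z∈q = x∈q ; agree = agree }
... | yes x∈p | no  x∉q = inj₂ record { z∉p = x∉q ; z∈q = x∈p ; agree = λ {y} y≢x → ⇔-sym (agree y≢x) }
... | yes x∈p | yes x∈q = ⊥-elim (p≢q (agree⇒≡ agree (mk⇔ (λ _ → x∈q) (λ _ → x∈p))))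
... | no  x∉p | no  x∉q = ⊥-elim (p≢q (agree⇒≡ agree (mk⇔ (⊥-elim ∘ x∉p) (⊥-elim ∘ x∉q))))

injective⇒surjective : {f : Fin k → Fin k} → Injective _≡_ _≡_ f → ∀ y → ∃ λ x → f x ≡ y
injective⇒surjective {suc k} {f} f-injective y with any? (λ x → f x ≟ y)
... | yes hit = hit
... | no  miss =
  let i , j , i<j , eq = pigeonhole (n<1+n k) (λ x → punchOut (y≢f x))
  in ⊥-elim (<-irrefl (f-injective (punchOut-injective (y≢f i) (y≢f j) eq)) i<j)
  where
  y≢f : ∀ x → y ≢ f x
  y≢f x y≡fx = miss (x , sym y≡fx)

injective⇒↔ : (f : Fin k → Fin k) → Injective _≡_ _≡_ f → Fin k ↔ Fin k
injective⇒↔ f f-injective =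
  mk↔ₛ′ f (proj₁ ∘ surjective) (proj₂ ∘ surjective) (λ x → f-injective (proj₂ (surjective (f x))))
  where surjective = injective⇒surjective f-injective

to-injective : (π : A ↔ B) → Injective _≡_ _≡_ (Inverse.to π)
to-injective π = Injection.injective (↔⇒↣ π)

Fin⇒0< : Fin k → 0 < k
Fin⇒0< zero    = s≤s z≤n
Fin⇒0< (suc _) = s≤s z≤n

record Partition (P : Fin k → Set) : Set where
  field
    {k₁ k₂} : ℕ
    split   : Fin k ↔ (Fin k₁ ⊎ Fin k₂)
  open Inverse split public
  field
    from-inj₁ : ∀ a → P (from (inj₁ a))
    from-inj₂ : ∀ b → ¬ P (from (inj₂ b))

  left-nonempty : ∀ {x} → P x → Fin k₁
  left-nonempty {x} Px with to x in eq
  ... | inj₁ a = a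
  ... | inj₂ b = ⊥-elim (from-inj₂ b (subst P (sym (trans (cong from (sym eq)) (strictlyInverseʳ x))) Px))

  right-nonempty : ∀ {x} → ¬ P x → Fin k₂
  right-nonempty {x} ¬Px with to x in eq
  ... | inj₁ a = ⊥-elim (¬Px (subst P (trans (cong from (sym eq)) (strictlyInverseʳ x)) (from-inj₁ a)))
  ... | inj₂ b = b

  k₁+k₂≡k : k₁ + k₂ ≡ k
  k₁+k₂≡k = sym (↔⇒≡ (↔-sym +↔⊎ ↔-∘ split))

partition-swap : {P : Fin k → Set} → (∀ x → Dec (P x)) → Partition (¬_ ∘ P) → Partition P
partition-swap P? π = record
  { split     = ⊎-comm _ _ ↔-∘ split
  ; from-inj₁ = λ a → decidable-stable (P? _) (from-inj₂ a)
  ; from-inj₂ = from-inj₁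
  }
  where open Partition π

partition-cons : {P : Fin (suc k) → Set} → P zero → Partition (P ∘ suc) → Partition P
partition-cons P0 π = record
  { split     = mk↔ₛ′ to′ from′ to′∘from′ from′∘to′
  ; from-inj₁ = λ { zero → P0 ; (suc a) → from-inj₁ a }
  ; from-inj₂ = from-inj₂
  }
  where
  open Partition π
  to′ : Fin (suc _) → Fin (suc k₁) ⊎ Fin k₂
  to′ zero    = inj₁ zero
  to′ (suc x) = map₁ suc (to x)
  from′ : Fin (suc k₁) ⊎ Fin k₂ → Fin (suc _)
  from′ (inj₁ zero)    = zero
  from′ (inj₁ (suc a)) = suc (from (inj₁ a))
  from′ (inj₂ b)       = suc (from (inj₂ b))
  from′-map₁-suc : ∀ y → from′ (map₁ suc y) ≡ suc (from y)
  from′-map₁-suc (inj₁ a) = refl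
  from′-map₁-suc (inj₂ b) = refl
  to′∘from′ : ∀ y → to′ (from′ y) ≡ y
  to′∘from′ (inj₁ zero)    = refl
  to′∘from′ (inj₁ (suc a)) = cong (map₁ suc) (strictlyInverseˡ (inj₁ a))
  to′∘from′ (inj₂ b)       = cong (map₁ suc) (strictlyInverseˡ (inj₂ b))
  from′∘to′ : ∀ x → from′ (to′ x) ≡ x
  from′∘to′ zero    = refl
  from′∘to′ (suc x) = trans (from′-map₁-suc (to x)) (cong suc (strictlyInverseʳ x))

partition : {P : Fin k → Set} → (∀ x → Dec (P x)) → Partition P
partition {zero} P? = record
  { k₁        = 0
  ; k₂        = 0
  ; split     = mk↔ₛ′ (λ ()) (λ { (inj₁ ()) ; (inj₂ ()) }) (λ { (inj₁ ()) ; (inj₂ ()) }) (λ ())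
  ; from-inj₁ = λ ()
  ; from-inj₂ = λ ()
  }
partition {suc k} P? with P? zero
... | yes P0  = partition-cons P0 (partition (P? ∘ suc))
... | no  ¬P0 = partition-swap P? (partition-cons ¬P0 (partition (¬? ∘ P? ∘ suc)))

Coneᴿ : (Fin k → Fin k → Set) → Fin (suc k) → Fin (suc k) → Set
Coneᴿ R zero    _       = ⊤
Coneᴿ R (suc _) zero    = ⊥
Coneᴿ R (suc a) (suc b) = R a b

Coneᴿ-restriction : {R : Fin (suc k) → Fin (suc k) → Set} → (∀ v → R zero v) → (∀ a → ¬ R (suc a) zero) →
  ∀ u v → R u v ⇔ Coneᴿ (R on suc) u v
Coneᴿ-restriction zero≤ _        zero    v       = mk⇔ (λ _ → tt) (λ _ → zero≤ v)
Coneᴿ-restriction _     suc≰zero (suc a) zero    = mk⇔ (suc≰zero a) λ ()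
Coneᴿ-restriction _     _        (suc a) (suc b) = ⇔-refl

Pointwise-restrictions : {R : A ⊎ B → A ⊎ B → Set} →
  (∀ a b → ¬ R (inj₁ a) (inj₂ b)) → (∀ a b → ¬ R (inj₂ b) (inj₁ a)) →
  ∀ x y → R x y ⇔ Pointwise (R on inj₁) (R on inj₂) x y
Pointwise-restrictions _    _    (inj₁ a) (inj₁ b) = mk⇔ inj₁ drop-inj₁
Pointwise-restrictions ¬R₁₂ _    (inj₁ a) (inj₂ b) = mk⇔ (⊥-elim ∘ ¬R₁₂ a b) λ ()
Pointwise-restrictions _    ¬R₂₁ (inj₂ b) (inj₁ a) = mk⇔ (⊥-elim ∘ ¬R₂₁ a b) λ ()
Pointwise-restrictions _    _    (inj₂ a) (inj₂ b) = mk⇔ inj₂ drop-inj₂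

BAdj-cone : (D : DTerm k) → ∀ u v → BAdj (cone D) u v ⇔ Coneᴿ (BAdj D) u v
BAdj-cone D zero    zero    = mk⇔ (λ _ → tt) (λ _ → inj₂ refl)
BAdj-cone D zero    (suc v) = mk⇔ (λ _ → tt) (λ _ → inj₁ tt)
BAdj-cone D (suc u) zero    = mk⇔ (λ { (inj₁ ()) ; (inj₂ ()) }) λ ()
BAdj-cone D (suc u) (suc v) = mk⇔ (map₂ suc-injective) (map₂ (cong suc))

splitAt-injective : ∀ m {u v : Fin (m + k)} → splitAt m u ≡ splitAt m v → u ≡ v
splitAt-injective {k} m {u} {v} eq =
  trans (sym (join-splitAt m k u)) (trans (cong (join m k) eq) (join-splitAt m k v))

ArcSum-reflexive-closure : (D : DTerm m) (E : DTerm k) → ∀ x y →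
  (ArcSum D E x y ⊎ x ≡ y) ⇔ Pointwise (BAdj D) (BAdj E) x y
ArcSum-reflexive-closure D E (inj₁ a) (inj₁ b) =
  mk⇔ (inj₁ ∘ map₂ inj₁-injective) λ { (inj₁ adj) → map₂ (cong inj₁) adj }
ArcSum-reflexive-closure D E (inj₁ a) (inj₂ b) = mk⇔ (λ { (inj₁ ()) ; (inj₂ ()) }) λ ()
ArcSum-reflexive-closure D E (inj₂ a) (inj₁ b) = mk⇔ (λ { (inj₁ ()) ; (inj₂ ()) }) λ ()
ArcSum-reflexive-closure D E (inj₂ a) (inj₂ b) =
  mk⇔ (inj₂ ∘ map₂ inj₂-injective) λ { (inj₂ adj) → map₂ (cong inj₂) adj }

BAdj-⊕ : (D : DTerm m) (E : DTerm k) → ∀ u v →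
  BAdj (D ⊕ E) u v ⇔ Pointwise (BAdj D) (BAdj E) (splitAt m u) (splitAt m v)
BAdj-⊕ {m} D E u v = ArcSum-reflexive-closure D E (splitAt m u) (splitAt m v) ⇔-∘
  mk⇔ (map₂ (cong (splitAt m))) (map₂ (splitAt-injective m))

-- Extremality from digraphs

module _ (Adj : A → A → Set) where

  IsSource : A → Set
  IsSource v = ∀ w → Adj w v → w ≡ v

  IsChildOf : A → A → Set
  IsChildOf v p = p ≢ v × (∀ w → Adj w v ⇔ (Adj w p ⊎ w ≡ v))

  SourceOrChild : A → Set
  SourceOrChild v = IsSource v ⊎ ∃ (IsChildOf v)

sourceOrChild-transport : {Adj : A → A → Set} {Adj′ : B → B → Set} (π : A ↔ B) →
  (∀ u v → Adj u v ⇔ Adj′ (Inverse.to π u) (Inverse.to π v)) →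
  (∀ v → SourceOrChild Adj′ v) → ∀ v → SourceOrChild Adj v
sourceOrChild-transport {Adj = Adj} {Adj′} π adj soc v with soc (Inverse.to π v)
... | inj₁ source = inj₁ λ w w~v → to-injective π (source _ (Equivalence.to (adj w v) w~v))
... | inj₂ (p , p≢v , child) = inj₂ (from p , from-p≢v , child′)
  where
  open Inverse π
  open EquationalReasoning
  from-p≢v : from p ≢ v
  from-p≢v refl = p≢v (sym (strictlyInverseˡ p))
  child′ : ∀ w → Adj w v ⇔ (Adj w (from p) ⊎ w ≡ v)
  child′ w = begin
    Adj w v                                   ∼⟨ adj w v ⟩
    Adj′ (to w) (to v)                        ∼⟨ child (to w) ⟩
    (Adj′ (to w) p ⊎ to w ≡ to v)             ≡⟨ cong (λ q → Adj′ (to w) q ⊎ to w ≡ to v)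
                                                      (sym (strictlyInverseˡ p)) ⟩
    (Adj′ (to w) (to (from p)) ⊎ to w ≡ to v) ∼⟨ ⇔-sym (adj w (from p)) ⊎-⇔ mk⇔ (to-injective π) (cong to) ⟩
    (Adj w (from p) ⊎ w ≡ v)                  ∎

sourceOrChild-Pointwise : {R : A → A → Set} {S : B → B → Set} →
  (∀ a → SourceOrChild R a) → (∀ b → SourceOrChild S b) → ∀ v → SourceOrChild (Pointwise R S) v
sourceOrChild-Pointwise {R = R} {S} socR socS (inj₁ a) with socR a
... | inj₁ source = inj₁ λ { (inj₁ c) (inj₁ c~a) → cong inj₁ (source c c~a) }
... | inj₂ (p , p≢a , child) = inj₂ (inj₁ p , p≢a ∘ inj₁-injective , child′)
  where
  child′ : ∀ w → Pointwise R S w (inj₁ a) ⇔ (Pointwise R S w (inj₁ p) ⊎ w ≡ inj₁ a)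
  child′ (inj₁ c) =
    ((mk⇔ inj₁ drop-inj₁ ⊎-⇔ mk⇔ (cong inj₁) inj₁-injective) ⇔-∘ child c) ⇔-∘ mk⇔ drop-inj₁ inj₁
  child′ (inj₂ c) = mk⇔ (λ ()) λ { (inj₁ ()) ; (inj₂ ()) }
sourceOrChild-Pointwise {R = R} {S} socR socS (inj₂ b) with socS b
... | inj₁ source = inj₁ λ { (inj₂ c) (inj₂ c~b) → cong inj₂ (source c c~b) }
... | inj₂ (p , p≢b , child) = inj₂ (inj₂ p , p≢b ∘ inj₂-injective , child′)
  where
  child′ : ∀ w → Pointwise R S w (inj₂ b) ⇔ (Pointwise R S w (inj₂ p) ⊎ w ≡ inj₂ b)
  child′ (inj₁ c) = mk⇔ (λ ()) λ { (inj₁ ()) ; (inj₂ ()) }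
  child′ (inj₂ c) =
    ((mk⇔ inj₂ drop-inj₂ ⊎-⇔ mk⇔ (cong inj₂) inj₂-injective) ⇔-∘ child c) ⇔-∘ mk⇔ drop-inj₂ inj₂

sourceOrChild-Coneᴿ : {R : Fin k → Fin k → Set} → (∀ a → R a a) →
  (∀ a → SourceOrChild R a) → ∀ v → SourceOrChild (Coneᴿ R) v
sourceOrChild-Coneᴿ R-refl soc zero = inj₁ λ { zero _ → refl }
sourceOrChild-Coneᴿ {R = R} R-refl soc (suc a) with soc a
... | inj₁ source = inj₂ (zero , (λ ()) , child′)
  where
  child′ : ∀ w → Coneᴿ R w (suc a) ⇔ (Coneᴿ R w zero ⊎ w ≡ suc a)
  child′ zero    = mk⇔ inj₁ (λ _ → tt)
  child′ (suc c) = mk⇔ (λ c~a → inj₂ (cong suc (source c c~a))) λ { (inj₂ refl) → R-refl a }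
... | inj₂ (p , p≢a , child) = inj₂ (suc p , p≢a ∘ suc-injective , child′)
  where
  child′ : ∀ w → Coneᴿ R w (suc a) ⇔ (Coneᴿ R w (suc p) ⊎ w ≡ suc a)
  child′ zero    = mk⇔ inj₁ (λ _ → tt)
  child′ (suc c) = (⇔-refl ⊎-⇔ mk⇔ (cong suc) suc-injective) ⇔-∘ child c

BAdj-sourceOrChild : (D : DTerm k) → ∀ v → SourceOrChild (BAdj D) v
BAdj-sourceOrChild K₁       zero = inj₁ λ { zero _ → refl }
BAdj-sourceOrChild (cone D) = sourceOrChild-transport ↔-refl (BAdj-cone D)
  (sourceOrChild-Coneᴿ (λ _ → inj₂ refl) (BAdj-sourceOrChild D))
BAdj-sourceOrChild (D ⊕ E)  = sourceOrChild-transport +↔⊎ (BAdj-⊕ D E)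
  (sourceOrChild-Pointwise (BAdj-sourceOrChild D) (BAdj-sourceOrChild E))

extremal-of-sourceOrChild : {Adj : Fin n → Fin n → Set} → (∀ v → Adj v v) →
  (∀ v → SourceOrChild Adj v) → (𝒜 : Fin n → Subset n) → Injective _≡_ _≡_ 𝒜 →
  (f g : Fin n ⤖ Fin n) → (∀ x i → x ∈ 𝒜 i ⇔ Adj (Bijection.to f x) (Bijection.to g i)) →
  Extremal 𝒜
extremal-of-sourceOrChild {Adj = Adj} Adj-refl soc 𝒜 𝒜-injective f⤖ g⤖ ∈⇔Adj =
  𝒜-injective , nonempty , extremal-at
  where
  open Inverse (⤖⇒↔ f⤖) using () renaming (to to f; from to f⁻¹; strictlyInverseˡ to f∘f⁻¹)
  open Inverse (⤖⇒↔ g⤖) using () renaming (to to g; from to g⁻¹; strictlyInverseˡ to g∘g⁻¹)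

  ∈𝒜g⁻¹⇔Adj : ∀ y v → y ∈ 𝒜 (g⁻¹ v) ⇔ Adj (f y) v
  ∈𝒜g⁻¹⇔Adj y v = subst (λ u → y ∈ 𝒜 (g⁻¹ v) ⇔ Adj (f y) u) (g∘g⁻¹ v) (∈⇔Adj y (g⁻¹ v))

  nonempty : ∀ i → Nonempty (𝒜 i)
  nonempty i = f⁻¹ (g i) ,
    Equivalence.from (∈⇔Adj _ i) (subst (λ u → Adj u (g i)) (sym (f∘f⁻¹ (g i))) (Adj-refl (g i)))

  extremal-at : ∀ x → (∃[ i ] Empty (𝒜 i - x)) ⊎ (∃[ i ] ∃[ j ] (i ≢ j × 𝒜 i - x ≡ 𝒜 j - x))
  extremal-at x with soc (f x)
  ... | inj₁ source = inj₁ (g⁻¹ (f x) , λ (y , y∈𝒜-x) →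
    let y∈𝒜 , y≢x = Equivalence.to x∈p-y⇔x∈p×x≢y y∈𝒜-x in
    y≢x (to-injective (⤖⇒↔ f⤖) (source (f y) (Equivalence.to (∈𝒜g⁻¹⇔Adj y (f x)) y∈𝒜))))
  ... | inj₂ (p , p≢fx , child) =
    inj₂ (g⁻¹ (f x) , g⁻¹ p , g⁻¹-distinct , Equivalence.from p-x≡q-x⇔agree agree)
    where
    g⁻¹-distinct : g⁻¹ (f x) ≢ g⁻¹ p
    g⁻¹-distinct eq = p≢fx (trans (sym (g∘g⁻¹ p)) (trans (cong g (sym eq)) (g∘g⁻¹ (f x))))
    agree : ∀ {y} → y ≢ x → y ∈ 𝒜 (g⁻¹ (f x)) ⇔ y ∈ 𝒜 (g⁻¹ p)
    agree {y} y≢x = ⇔-sym (∈𝒜g⁻¹⇔Adj y p) ⇔-∘ (mk⇔ drop-≡ inj₁ ⇔-∘ (child (f y) ⇔-∘ ∈𝒜g⁻¹⇔Adj y (f x)))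
      where
      drop-≡ : Adj (f y) p ⊎ f y ≡ f x → Adj (f y) p
      drop-≡ (inj₁ adj) = adj
      drop-≡ (inj₂ eq)  = ⊥-elim (y≢x (to-injective (⤖⇒↔ f⤖) eq))

-- Forest orders are realised by digraphs

record IsForestOrder {A : Set} (_≤_ : A → A → Set) : Set where
  field
    _≤?_           : ∀ a b → Dec (a ≤ b)
    ≤-refl         : ∀ a → a ≤ a
    ≤-trans        : ∀ {a b c} → a ≤ b → b ≤ c → a ≤ c
    ≤-antisym      : ∀ {a b} → a ≤ b → b ≤ a → a ≡ b
    ≤-linear-below : ∀ {a b c} → a ≤ c → b ≤ c → a ≤ b ⊎ b ≤ a

  minimal-in : (xs : List A) → A → ∃ λ c → ∀ {w} → w ∈ₗ xs → w ≤ c → c ≤ w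
  minimal-in []       c = c , λ ()
  minimal-in (x ∷ xs) c₀ with minimal-in xs c₀
  ... | c , c-min with x ≤? c
  ...   | yes x≤c = x , λ { (here refl) _ → ≤-refl x
                          ; (there w∈xs) w≤x → ≤-trans x≤c (c-min w∈xs (≤-trans w≤x x≤c)) }
  ...   | no  x≰c = c , λ { (here refl) x≤c → ⊥-elim (x≰c x≤c) ; (there w∈xs) → c-min w∈xs }

isForestOrder-on : {_≤_ : B → B → Set} {f : A → B} → Injective _≡_ _≡_ f →
  IsForestOrder _≤_ → IsForestOrder (_≤_ on f)
isForestOrder-on f-injective ≤-forest = record
  { _≤?_           = λ a b → _ ≤? _
  ; ≤-refl         = λ a → ≤-refl _
  ; ≤-trans        = ≤-trans
  ; ≤-antisym      = λ a≤b b≤a → f-injective (≤-antisym a≤b b≤a)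
  ; ≤-linear-below = ≤-linear-below
  }
  where open IsForestOrder ≤-forest

minimal : {_≤_ : Fin k → Fin k → Set} → IsForestOrder _≤_ → Fin k → ∃ λ r → ∀ w → w ≤ r → w ≡ r
minimal {k} ≤-forest x =
  let r , r-min = minimal-in (allFin k) x in r , λ w w≤r → ≤-antisym w≤r (r-min (∈-allFin w) w≤r)
  where open IsForestOrder ≤-forest

-- The size is left free so that the digraph of a disjoint union can be D₁ ⊕ D₂ without a cast
-- along k₁ + k₂ ≡ k.
record Realisation {A : Set} (R : A → A → Set) : Set where
  field
    {size}  : ℕ
    digraph : DTerm size
    label   : A ↔ Fin size
    adj     : ∀ a b → R a b ⇔ BAdj digraph (Inverse.to label a) (Inverse.to label b)

realisation-transport : {R : A → A → Set} {S : B → B → Set} (π : A ↔ B) →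
  (∀ a b → R a b ⇔ S (Inverse.to π a) (Inverse.to π b)) → Realisation S → Realisation R
realisation-transport π R⇔S ρ = record
  { digraph = digraph
  ; label   = label ↔-∘ π
  ; adj     = λ a b → adj _ _ ⇔-∘ R⇔S a b
  }
  where open Realisation ρ

realisation-⇔ : {R S : A → A → Set} → (∀ a b → R a b ⇔ S a b) → Realisation S → Realisation R
realisation-⇔ = realisation-transport ↔-refl

realisation-from : {R : A → A → Set} (π : A ↔ B) → Realisation (R on Inverse.from π) → Realisation R
realisation-from {R = R} π = realisation-transport π λ a b →
  subst₂ (λ a′ b′ → R a b ⇔ R a′ b′) (sym (strictlyInverseʳ a)) (sym (strictlyInverseʳ b)) ⇔-refl
  where open Inverse π

realisation-K₁ : {R : Fin 1 → Fin 1 → Set} → R zero zero → Realisation R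
realisation-K₁ R00 = record
  { digraph = K₁
  ; label   = ↔-refl
  ; adj     = λ { zero zero → mk⇔ (λ _ → inj₂ refl) (λ _ → R00) }
  }

realisation-Coneᴿ : {R : Fin k → Fin k → Set} → Realisation R → Realisation (Coneᴿ R)
realisation-Coneᴿ {R = R} ρ = record
  { digraph = cone digraph
  ; label   = lift₀ label
  ; adj     = λ u v → ⇔-sym (BAdj-cone digraph _ _) ⇔-∘ lifted u v
  }
  where
  open Realisation ρ
  lifted : ∀ u v →
    Coneᴿ R u v ⇔ Coneᴿ (BAdj digraph) (Inverse.to (lift₀ label) u) (Inverse.to (lift₀ label) v)
  lifted zero    zero    = ⇔-refl
  lifted zero    (suc b) = ⇔-refl
  lifted (suc a) zero    = ⇔-refl
  lifted (suc a) (suc b) = adj a b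

realisation-Pointwise : {R : A → A → Set} {S : B → B → Set} →
  Realisation R → Realisation S → Realisation (Pointwise R S)
realisation-Pointwise {R = R} {S} ρ σ = record
  { digraph = ρ.digraph ⊕ σ.digraph
  ; label   = ↔-sym +↔⊎ ↔-∘ (ρ.label ⊎-↔ σ.label)
  ; adj     = λ x y → ⇔-sym (BAdj-⊕ ρ.digraph σ.digraph _ _) ⇔-∘
      subst₂ (λ u v → Pointwise R S x y ⇔ Pointwise (BAdj ρ.digraph) (BAdj σ.digraph) u v)
             (sym (splitAt-join ρ.size σ.size (ℓ x))) (sym (splitAt-join ρ.size σ.size (ℓ y)))
             (labelled x y)
  }
  where
  module ρ = Realisation ρ
  module σ = Realisation σ
  ℓ : _ ⊎ _ → Fin ρ.size ⊎ Fin σ.size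
  ℓ = Inverse.to (ρ.label ⊎-↔ σ.label)
  labelled : ∀ x y → Pointwise R S x y ⇔ Pointwise (BAdj ρ.digraph) (BAdj σ.digraph) (ℓ x) (ℓ y)
  labelled (inj₁ a) (inj₁ b) = mk⇔ inj₁ drop-inj₁ ⇔-∘ (ρ.adj a b ⇔-∘ mk⇔ drop-inj₁ inj₁)
  labelled (inj₁ a) (inj₂ b) = mk⇔ (λ ()) (λ ())
  labelled (inj₂ a) (inj₁ b) = mk⇔ (λ ()) (λ ())
  labelled (inj₂ a) (inj₂ b) = mk⇔ inj₂ drop-inj₂ ⇔-∘ (σ.adj a b ⇔-∘ mk⇔ drop-inj₂ inj₂)

model-of-realisation : {R : Fin k → Fin k → Set} → Realisation R →
  Σ (DTerm k) λ D → Σ (Fin k ↔ Fin k) λ π → ∀ a b → R a b ⇔ BAdj D (Inverse.to π a) (Inverse.to π b)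
model-of-realisation record { digraph = D ; label = π ; adj = adj } with ↔⇒≡ π
... | refl = D , π , adj

ForestOrdersRealisable : ℕ → Set₁
ForestOrdersRealisable k = ∀ {_≤_ : Fin k → Fin k → Set} → Fin k → IsForestOrder _≤_ → Realisation _≤_

module ForestDecomposition {k} {_≤_ : Fin (suc (suc k)) → Fin (suc (suc k)) → Set}
  (≤-forest : IsForestOrder _≤_) (IH : ∀ {j} → j < suc (suc k) → ForestOrdersRealisable j)
  {r} (r-min : ∀ w → w ≤ r → w ≡ r) where

  open IsForestOrder ≤-forest

  realisation-with-root : (∀ v → r ≤ v) → Realisation _≤_
  realisation-with-root r≤ = realisation-from π
    (realisation-⇔ (Coneᴿ-restriction (λ v → r≤ _) suc≰zero)
      (realisation-Coneᴿ (IH (n<1+n _) zero (isForestOrder-on suc-injective ≤-forest′))))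
    where
    π = transpose r zero
    open Inverse π
    from-injective : ∀ {u v} → from u ≡ from v → u ≡ v
    from-injective = to-injective (↔-sym π)
    ≤-forest′ : IsForestOrder (_≤_ on from)
    ≤-forest′ = isForestOrder-on from-injective ≤-forest
    suc≰zero : ∀ a → ¬ (from (suc a) ≤ from zero)
    suc≰zero a a≤r with from-injective {suc a} {zero} (r-min _ a≤r)
    ... | ()

  realisation-without-root : ∀ {y} → ¬ r ≤ y → Realisation _≤_
  realisation-without-root r≰y = realisation-from split
    (realisation-⇔ (Pointwise-restrictions up≰rest rest≰up)
      (realisation-Pointwise
        (IH k₁<k (left-nonempty (≤-refl r)) (isForestOrder-on inj₁-injective ≤-forest′))
        (IH k₂<k (right-nonempty r≰y) (isForestOrder-on inj₂-injective ≤-forest′))))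
    where
    open Partition (partition (r ≤?_))
    ≤-forest′ : IsForestOrder (_≤_ on from)
    ≤-forest′ = isForestOrder-on (to-injective (↔-sym split)) ≤-forest
    k₁<k : k₁ < suc (suc k)
    k₁<k = subst (k₁ <_) k₁+k₂≡k (m<m+n k₁ (Fin⇒0< (right-nonempty r≰y)))
    k₂<k : k₂ < suc (suc k)
    k₂<k = subst (k₂ <_) k₁+k₂≡k (m<n+m k₂ (Fin⇒0< (left-nonempty (≤-refl r))))
    up≰rest : ∀ a b → ¬ (from (inj₁ a) ≤ from (inj₂ b))
    up≰rest a b a≤b = from-inj₂ b (≤-trans (from-inj₁ a) a≤b)
    rest≰up : ∀ a b → ¬ (from (inj₂ b) ≤ from (inj₁ a))
    rest≰up a b b≤a with ≤-linear-below b≤a (from-inj₁ a)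
    ... | inj₁ b≤r = from-inj₂ b (subst (r ≤_) (sym (r-min _ b≤r)) (≤-refl r))
    ... | inj₂ r≤b = from-inj₂ b r≤b

forestOrder-realisation : ∀ k → ForestOrdersRealisable k
forestOrder-realisation = <-rec ForestOrdersRealisable step
  where
  step : ∀ k → (∀ {j} → j < k → ForestOrdersRealisable j) → ForestOrdersRealisable k
  step (suc zero)    _  _ ≤-forest = realisation-K₁ (IsForestOrder.≤-refl ≤-forest zero)
  step (suc (suc k)) IH x ≤-forest with minimal ≤-forest x
  ... | r , r-min with all? (IsForestOrder._≤?_ ≤-forest r)
  ...   | yes r≤ = realisation-with-root r≤
    where open ForestDecomposition ≤-forest IH r-min
  ...   | no ¬r≤ = realisation-without-root (proj₂ (¬∀⟶∃¬ _ _ (IsForestOrder._≤?_ ≤-forest r) ¬r≤))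
    where open ForestDecomposition ≤-forest IH r-min

-- Counting flips

length-filter-+-filter-¬ : {P : A → Set} (P? : ∀ x → Dec (P x)) (xs : List A) →
  length (filter P? xs) + length (filter (¬? ∘ P?) xs) ≡ length xs
length-filter-+-filter-¬ P? []       = refl
length-filter-+-filter-¬ P? (x ∷ xs) with P? x
... | yes _ = cong suc (length-filter-+-filter-¬ P? xs)
... | no  _ = trans (+-suc _ _) (cong suc (length-filter-+-filter-¬ P? xs))

module FlipCounting (lower upper : Fin n → Subset n) (flip : ∀ z → Flip z (lower z) (upper z)) where

  Within : List (Subset n) → List (Fin n) → Set
  Within 𝒮 L = ∀ {z} → z ∈ₗ L → lower z ∈ₗ 𝒮 × upper z ∈ₗ 𝒮

  Preserve : (Subset n → Set) → List (Fin n) → Set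
  Preserve Q L = ∀ {z} → z ∈ₗ L → Q (lower z) ⇔ Q (upper z)

  module Classes {Q : Subset n → Set} (Q? : ∀ S → Dec (Q S)) {𝒮 L}
                 (within : Within 𝒮 L) (preserve : Preserve Q L) where

    𝒮⁺ 𝒮⁻ : List (Subset n)
    𝒮⁺ = filter Q? 𝒮
    𝒮⁻ = filter (¬? ∘ Q?) 𝒮

    L⁺ L⁻ : List (Fin n)
    L⁺ = filter (Q? ∘ lower) L
    L⁻ = filter (¬? ∘ Q? ∘ lower) L

    within⁺ : Within 𝒮⁺ L⁺
    within⁺ z∈L⁺ =
      let z∈L , Q-lower   = ∈-filter⁻ (Q? ∘ lower) z∈L⁺
          lower∈ , upper∈ = within z∈L
      in ∈-filter⁺ Q? lower∈ Q-lower , ∈-filter⁺ Q? upper∈ (Equivalence.to (preserve z∈L) Q-lower)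

    within⁻ : Within 𝒮⁻ L⁻
    within⁻ z∈L⁻ =
      let z∈L , ¬Q-lower  = ∈-filter⁻ (¬? ∘ Q? ∘ lower) z∈L⁻
          lower∈ , upper∈ = within z∈L
      in ∈-filter⁺ (¬? ∘ Q?) lower∈ ¬Q-lower ,
         ∈-filter⁺ (¬? ∘ Q?) upper∈ (¬Q-lower ∘ Equivalence.from (preserve z∈L))

    combine : ∀ {a b} → a + length L⁺ ≤ length 𝒮⁺ → b + length L⁻ ≤ length 𝒮⁻ →
      (a + b) + length L ≤ length 𝒮
    combine {a} {b} bound⁺ bound⁻ = begin
      (a + b) + length L                ≡⟨ cong (a + b +_) (length-filter-+-filter-¬ (Q? ∘ lower) L) ⟨
      (a + b) + (length L⁺ + length L⁻) ≡⟨ interchange a b (length L⁺) (length L⁻) ⟩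
      (a + length L⁺) + (b + length L⁻) ≤⟨ +-mono-≤ bound⁺ bound⁻ ⟩
      length 𝒮⁺ + length 𝒮⁻             ≡⟨ length-filter-+-filter-¬ Q? 𝒮 ⟩
      length 𝒮                          ∎
      where open ≤-Reasoning

  -- Split by membership of the first direction x: the other flips stay inside a class, and the
  -- ends of the flip at x make both classes nonempty.
  flips-forest′ : ∀ m {𝒮 S} L → length L ≤ m → Unique L → Within 𝒮 L → S ∈ₗ 𝒮 → 1 + length L ≤ length 𝒮
  flips-forest′ _       []      _           _              _      (here _)  = s≤s z≤n
  flips-forest′ _       []      _           _              _      (there _) = s≤s z≤n
  flips-forest′ (suc m) (x ∷ L) (s≤s |L|≤m) (x≢L ∷ unique) within _ =
    combine {1} {1}
      (flips-forest′ m L⁺ (ℕ.≤-trans (length-filter _ L) |L|≤m) (filter⁺ _ unique) within⁺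
        (∈-filter⁺ (x ∈?_) (proj₂ (within (here refl))) (Flip.z∈q (flip x))))
      (flips-forest′ m L⁻ (ℕ.≤-trans (length-filter _ L) |L|≤m) (filter⁺ _ unique) within⁻
        (∈-filter⁺ (¬? ∘ (x ∈?_)) (proj₁ (within (here refl))) (Flip.z∉p (flip x))))
    where open Classes (x ∈?_) (within ∘ there) (λ z∈L → Flip.agree (flip _) (lookup x≢L z∈L))

  flips-forest : ∀ {𝒮 S} L → Unique L → Within 𝒮 L → S ∈ₗ 𝒮 → 1 + length L ≤ length 𝒮
  flips-forest L = flips-forest′ (length L) L ℕ.≤-refl

  flips-two-classes : ∀ {Q : Subset n → Set} (Q? : ∀ S → Dec (Q S)) {𝒮 L S₁ S₂} →
    Unique L → Within 𝒮 L → Preserve Q L → S₁ ∈ₗ 𝒮 → Q S₁ → S₂ ∈ₗ 𝒮 → ¬ Q S₂ → 2 + length L ≤ length 𝒮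
  flips-two-classes Q? unique within preserve S₁∈𝒮 QS₁ S₂∈𝒮 ¬QS₂ =
    combine {1} {1} (flips-forest L⁺ (filter⁺ _ unique) within⁺ (∈-filter⁺ Q? S₁∈𝒮 QS₁))
                    (flips-forest L⁻ (filter⁺ _ unique) within⁻ (∈-filter⁺ (¬? ∘ Q?) S₂∈𝒮 ¬QS₂))
    where open Classes Q? within preserve

  -- No flip of L crosses between the classes {x ∈ S}, {x ∉ S ∋ y} and {x, y ∉ S}, which contain
  -- upper x, lower x and E respectively.
  upper-collision-bound : ∀ {x y 𝒮 L E} → x ≢ y → upper x ≡ upper y → Unique L → All (_≢ x) L →
    Within 𝒮 L → lower x ∈ₗ 𝒮 → upper x ∈ₗ 𝒮 → E ∈ₗ 𝒮 → x ∉ E → y ∉ E → 3 + length L ≤ length 𝒮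
  upper-collision-bound {x} {y} {L = L} x≢y upper≡ unique L≢x within lower∈𝒮 upper∈𝒮 E∈𝒮 x∉E y∉E =
    combine {1} {2}
      (flips-forest L⁺ (filter⁺ _ unique) within⁺ (∈-filter⁺ (x ∈?_) upper∈𝒮 (Flip.z∈q (flip x))))
      (flips-two-classes (y ∈?_) (filter⁺ _ unique) within⁻ preserve-y
        (∈-filter⁺ (¬? ∘ (x ∈?_)) lower∈𝒮 (Flip.z∉p (flip x))) y∈lower-x
        (∈-filter⁺ (¬? ∘ (x ∈?_)) E∈𝒮 x∉E) y∉E)
    where
    open Classes (x ∈?_) within (λ z∈L → Flip.agree (flip _) (≢-sym (lookup L≢x z∈L)))
    y∈lower-x : y ∈ lower x
    y∈lower-x = Equivalence.from (Flip.agree (flip x) (≢-sym x≢y))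
                                 (subst (y ∈_) (sym upper≡) (Flip.z∈q (flip y)))
    x∈lower-y : x ∈ lower y
    x∈lower-y = Equivalence.from (Flip.agree (flip y) x≢y) (subst (x ∈_) upper≡ (Flip.z∈q (flip x)))
    preserve-y : Preserve (y ∈_) L⁻
    preserve-y {z} z∈L⁻ = Flip.agree (flip z) y≢z
      where
      y≢z : y ≢ z
      y≢z refl = proj₂ (∈-filter⁻ (¬? ∘ (x ∈?_) ∘ lower) {xs = L} z∈L⁻) x∈lower-y

-- Extremal systems

module ExtremalSystem (𝒜 : Fin (suc n) → Subset (suc n)) (𝒜-extremal : Extremal 𝒜) where

  𝒮 : List (Subset (suc n))
  𝒮 = ∅ ∷ map 𝒜 (allFin (suc n))

  member : ∀ i → 𝒜 i ∈ₗ 𝒮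
  member i = there (∈-map⁺ 𝒜 (∈-allFin i))

  record FlipAt (x : Fin (suc n)) : Set where
    field
      lower   : Subset (suc n)
      upper   : Fin (suc n)
      lower∈𝒮 : lower ∈ₗ 𝒮
      flip    : Flip x lower (𝒜 upper)

  flip-at : ∀ x → FlipAt x
  flip-at x with proj₂ (proj₂ 𝒜-extremal) x
  ... | inj₁ (i , 𝒜ᵢ-x-empty) =
    record { lower = ∅ ; upper = i ; lower∈𝒮 = here refl
           ; flip = flip-from-∅ (proj₁ (proj₂ 𝒜-extremal) i) 𝒜ᵢ-x-empty }
  ... | inj₂ (i , j , i≢j , 𝒜ᵢ-x≡𝒜ⱼ-x)
    with flip-between (i≢j ∘ proj₁ 𝒜-extremal) (Equivalence.to p-x≡q-x⇔agree 𝒜ᵢ-x≡𝒜ⱼ-x)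
  ...   | inj₁ flip = record { lower = 𝒜 i ; upper = j ; lower∈𝒮 = member i ; flip = flip }
  ...   | inj₂ flip = record { lower = 𝒜 j ; upper = i ; lower∈𝒮 = member j ; flip = flip }

  lower : Fin (suc n) → Subset (suc n)
  lower x = FlipAt.lower (flip-at x)

  upper : Fin (suc n) → Fin (suc n)
  upper x = FlipAt.upper (flip-at x)

  flip : ∀ x → Flip x (lower x) (𝒜 (upper x))
  flip x = FlipAt.flip (flip-at x)

  open FlipCounting lower (𝒜 ∘ upper) flip

  upper-injective : Injective _≡_ _≡_ upper
  upper-injective {x} {y} upper≡ with x ≟ y
  ... | yes x≡y = x≡y
  ... | no  x≢y = ⊥-elim (ℕ.<-irrefl refl (subst₂ _≤_ (cong (3 +_) length-others) length-𝒮 bound))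
    where
    others : List (Fin (suc n))
    others = map (punchIn x) (allFin n)
    others≢x : All (_≢ x) others
    others≢x = All.tabulate λ z∈others →
      let j , _ , z≡ = ∈-map⁻ (punchIn x) z∈others in subst (_≢ x) (sym z≡) (punchInᵢ≢i x j)
    bound : 3 + length others ≤ length 𝒮
    bound = upper-collision-bound x≢y (cong 𝒜 upper≡) (map⁺ (punchIn-injective x _ _) (allFin⁺ n)) others≢x
      (λ {z} _ → FlipAt.lower∈𝒮 (flip-at z) , member (upper z))
      (FlipAt.lower∈𝒮 (flip-at x)) (member (upper x)) (here refl) ∉⊥ ∉⊥
    length-others : length others ≡ n
    length-others = trans (length-map (punchIn x) (allFin n)) (length-tabulate id)
    length-𝒮 : length 𝒮 ≡ 2 + n
    length-𝒮 = cong suc (trans (length-map 𝒜 (allFin (suc n))) (length-tabulate id))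

  upper↔ : Fin (suc n) ↔ Fin (suc n)
  upper↔ = injective⇒↔ upper upper-injective

  open Inverse upper↔ using () renaming (from to upper⁻¹; strictlyInverseˡ to upper∘upper⁻¹)

  -- w is the parent of z: the upper set of z with z removed is that of w.
  _⋖_ : Fin (suc n) → Fin (suc n) → Set
  w ⋖ z = lower z ≡ 𝒜 (upper w)

  ⋖-wellFounded : WellFounded _⋖_
  ⋖-wellFounded = Subrelation.wellFounded ⋖⇒smaller (On.wellFounded (λ z → ∣ 𝒜 (upper z) ∣) <-wellFounded)
    where
    ⋖⇒smaller : ∀ {w z} → w ⋖ z → ∣ 𝒜 (upper w) ∣ < ∣ 𝒜 (upper z) ∣
    ⋖⇒smaller {z = z} w⋖z = subst (λ S → ∣ S ∣ < ∣ 𝒜 (upper z) ∣) w⋖z (p⊂q⇒∣p∣<∣q∣ (Flip.p⊂q (flip z)))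

  parent : ∀ {y z} → y ≢ z → y ∈ 𝒜 (upper z) → ∃ λ w → w ⋖ z × y ∈ 𝒜 (upper w)
  parent {y} {z} y≢z y∈ with FlipAt.lower∈𝒮 (flip-at z) | Equivalence.from (Flip.agree (flip z) y≢z) y∈
  ... | here lower≡∅ | y∈lower = ⊥-elim (∉⊥ (subst (y ∈_) lower≡∅ y∈lower))
  ... | there lower∈ | y∈lower with ∈-map⁻ 𝒜 lower∈
  ...   | j , _ , lower≡𝒜ⱼ = upper⁻¹ j , w⋖z , subst (y ∈_) w⋖z y∈lower
    where
    w⋖z : upper⁻¹ j ⋖ z
    w⋖z = trans lower≡𝒜ⱼ (cong 𝒜 (sym (upper∘upper⁻¹ j)))

  _≼_ : Fin (suc n) → Fin (suc n) → Set
  x ≼ y = x ∈ 𝒜 (upper y)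

  ≼-trans-acc : ∀ {x y z} → Acc _⋖_ z → x ≼ y → y ≼ z → x ≼ z
  ≼-trans-acc {y = y} {z} (acc rs) x≼y y≼z with y ≟ z
  ... | yes refl = x≼y
  ... | no  y≢z with parent y≢z y≼z
  ...   | w , w⋖z , y≼w = Flip.p⊆q (flip z) (subst (_ ∈_) (sym w⋖z) (≼-trans-acc (rs w⋖z) x≼y y≼w))

  ≼-linear-below-acc : ∀ {x y z} → Acc _⋖_ z → x ≼ z → y ≼ z → x ≼ y ⊎ y ≼ x
  ≼-linear-below-acc {x} {y} {z} (acc rs) x≼z y≼z with x ≟ z | y ≟ z
  ... | yes refl | _        = inj₂ y≼z
  ... | no _     | yes refl = inj₁ x≼z
  ... | no x≢z   | no y≢z with parent x≢z x≼z
  ...   | w , w⋖z , x≼w =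
    ≼-linear-below-acc (rs w⋖z) x≼w (subst (y ∈_) w⋖z (Equivalence.from (Flip.agree (flip z) y≢z) y≼z))

  ≼-isForestOrder : IsForestOrder _≼_
  ≼-isForestOrder = record
    { _≤?_           = λ x y → x ∈? 𝒜 (upper y)
    ; ≤-refl         = λ x → Flip.z∈q (flip x)
    ; ≤-trans        = ≼-trans
    ; ≤-antisym      = λ x≼y y≼x → upper-injective (proj₁ 𝒜-extremal
                         (⊆-antisym (λ w≼x → ≼-trans w≼x x≼y) (λ w≼y → ≼-trans w≼y y≼x)))
    ; ≤-linear-below = ≼-linear-below-acc (⋖-wellFounded _)
    }
    where
    ≼-trans : ∀ {x y z} → x ≼ y → y ≼ z → x ≼ z
    ≼-trans = ≼-trans-acc (⋖-wellFounded _)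

  model : Σ (DTerm (suc n)) λ D → Σ (Fin (suc n) ⤖ Fin (suc n)) λ f → Σ (Fin (suc n) ⤖ Fin (suc n)) λ g →
    ∀ x i → x ∈ 𝒜 i ⇔ BAdj D (Bijection.to f x) (Bijection.to g i)
  model with model-of-realisation (forestOrder-realisation _ zero ≼-isForestOrder)
  ... | D , π , adj = D , ↔⇒⤖ π , ↔⇒⤖ (π ↔-∘ ↔-sym upper↔) , λ x i →
    subst (λ j → x ∈ 𝒜 j ⇔ BAdj D (Inverse.to π x) (Inverse.to π (upper⁻¹ i)))
          (upper∘upper⁻¹ i) (adj x (upper⁻¹ i))

theorem6 : (n : ℕ) → 1 ≤ n → (𝒜 : Fin n → Subset n) → Injective _≡_ _≡_ 𝒜 →
    Extremal 𝒜 ⇔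
      (Σ (DTerm n) λ D → Σ (Fin n ⤖ Fin n) λ f → Σ (Fin n ⤖ Fin n) λ g →
        (∀ (x i : Fin n) → (x ∈ 𝒜 i) ⇔ BAdj D (Bijection.to f x) (Bijection.to g i)))
theorem6 (suc n) _ 𝒜 𝒜-injective = mk⇔ (ExtremalSystem.model 𝒜) λ (D , f , g , ∈⇔BAdj) →
  extremal-of-sourceOrChild (λ _ → inj₂ refl) (BAdj-sourceOrChild D) 𝒜 𝒜-injective f g ∈⇔BAdj
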